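{- Let $\Lambda$ be a numerical semigroup. (1) If $\Lambda$ is symmetric then it is acute. (2) If $\Lambda$ is pseudo-symmetric then it is acute. (3) If $\Lambda$ is Arf then it is acute. (4) If $\Lambda$ is generated by an interval then it is acute.
   Context: A numerical semigroup is a subset $\Lambda\subseteq\mathbb{N}_0$ containing $0$, closed under addition, with finite complement in $\mathbb{N}_0$; elements of $\mathbb{N}_0\setminus\Lambda$ are gaps, $g$ (genus) is their number, and the conductor $c$ is the smallest integer with $c+\mathbb{N}_0\subseteq\Lambda$. $\Lambda$ is symmetric if $c=2g$, pseudo-symmetric if $c=2g-1$. With enumeration $\lambda:\mathbb{N}_0\to\Lambda$ (increasing bijection), $\Lambda$ is Arf if $\lambda_a+\lambda_b-\lambda_k\in\Lambda$ for all $a\geq b\geq k$. $\Lambda$ is generated by the interval $\{i,\dots,j\}$ ($1\le i\le j$) if $\Lambda=\{n_i i+\dots+n_j j: n_i,\dots,n_j\in\mathbb{N}_0\}$. $\Lambda$ is ordinary if $\Lambda=\{0\}\cup\{i\in\mathbb{N}_0:i\geq c\}$ for some $c$ (so $\mathbb{N}_0$ is ordinary). For $\Lambda\neq\mathbb{N}_0$, the dominant $d$ is the largest element of $\Lambda$ smaller than $c$; the subconductor $c'$ is the smallest element of $\Lambda$ such that every integer in $[c',d]$ lies in $\Lambda$ (equivalently, the smallest non-gap having the same number of smaller gaps as $d$). For non-ordinary $\Lambda$ (where $c'>0$), the subdominant $d'$ is the largest element of $\Lambda$ smaller than $c'$. $\Lambda$ is acute if it is ordinary, or if it is non-ordinary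 and $c-d\leq c'-d'$. -}

module Defs where

open import Data.Nat using (ℕ; zero; suc; _+_; _*_; _∸_; _≤_; _<_)
open import Data.Bool using (Bool; true; false; if_then_else_)
open import Data.Product using (Σ; _×_; _,_)
open import Data.Sum using (_⊎_)
open import Relation.Binary.PropositionalEquality using (_≡_)
open import Relation.Nullary using (¬_)

record NumericalSemigroup : Set where
  field
    mem        : ℕ → Bool
    zero-mem   : mem 0 ≡ true
    add-closed : ∀ a b → mem a ≡ true → mem b ≡ true → mem (a + b) ≡ true
    cofinite   : Σ ℕ λ N → ∀ n → N ≤ n → mem n ≡ true

open NumericalSemigroup public

infix 4 _∈Λ_
_∈Λ_ : ℕ → NumericalSemigroup → Set
n ∈Λ Λ = mem Λ n ≡ true

gapsBelow : NumericalSemigroup → ℕ → ℕ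
gapsBelow Λ zero    = 0
gapsBelow Λ (suc n) = gapsBelow Λ n + (if mem Λ n then 0 else 1)

IsConductor : NumericalSemigroup → ℕ → Set
IsConductor Λ c =
  (∀ n → c ≤ n → n ∈Λ Λ) ×
  (∀ m → (∀ n → m ≤ n → n ∈Λ Λ) → c ≤ m)

-- g is the genus: the number of gaps (all gaps lie below any N with N + ℕ ⊆ Λ)
IsGenus : NumericalSemigroup → ℕ → Set
IsGenus Λ g = Σ ℕ λ N → (∀ n → N ≤ n → n ∈Λ Λ) × g ≡ gapsBelow Λ N

Symmetric : NumericalSemigroup → Set
Symmetric Λ = Σ ℕ λ c → Σ ℕ λ g → IsConductor Λ c × IsGenus Λ g × c ≡ 2 * g

-- c = 2g - 1 (over the integers), written as c + 1 = 2g
PseudoSymmetric : NumericalSemigroup → Set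
PseudoSymmetric Λ = Σ ℕ λ c → Σ ℕ λ g → IsConductor Λ c × IsGenus Λ g × c + 1 ≡ 2 * g

IsEnumeration : NumericalSemigroup → (ℕ → ℕ) → Set
IsEnumeration Λ e =
  (∀ n → e n ∈Λ Λ) ×
  (∀ m n → m < n → e m < e n) ×
  (∀ x → x ∈Λ Λ → Σ ℕ λ n → e n ≡ x)

-- Arf: λ_a + λ_b - λ_k ∈ Λ for all a ≥ b ≥ k (here λ_a + λ_b ≥ λ_k, so ∸ is exact)
Arf : NumericalSemigroup → Set
Arf Λ = Σ (ℕ → ℕ) λ e → IsEnumeration Λ e ×
  (∀ a b k → b ≤ a → k ≤ b → (e a + e b ∸ e k) ∈Λ Λ)

data GenByInterval (i j : ℕ) : ℕ → Set where
  gen-zero : GenByInterval i j 0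
  gen-step : ∀ {k n} → i ≤ k → k ≤ j → GenByInterval i j n → GenByInterval i j (k + n)

IntervalGenerated : NumericalSemigroup → Set
IntervalGenerated Λ = Σ ℕ λ i → Σ ℕ λ j → 1 ≤ i × i ≤ j ×
  (∀ n → (n ∈Λ Λ → GenByInterval i j n) × (GenByInterval i j n → n ∈Λ Λ))

Ordinary : NumericalSemigroup → Set
Ordinary Λ = Σ ℕ λ c → ∀ n → (n ∈Λ Λ → (n ≡ 0 ⊎ c ≤ n)) × ((n ≡ 0 ⊎ c ≤ n) → n ∈Λ Λ)

IsDominant : NumericalSemigroup → ℕ → ℕ → Set
IsDominant Λ c d = d ∈Λ Λ × d < c × (∀ x → x ∈Λ Λ → x < c → x ≤ d)

IsSubconductor : NumericalSemigroup → ℕ → ℕ → Set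
IsSubconductor Λ d c' =
  c' ∈Λ Λ × (∀ n → c' ≤ n → n ≤ d → n ∈Λ Λ) ×
  (∀ x → x ∈Λ Λ → (∀ n → x ≤ n → n ≤ d → n ∈Λ Λ) → c' ≤ x)

IsSubdominant : NumericalSemigroup → ℕ → ℕ → Set
IsSubdominant Λ c' d' = d' ∈Λ Λ × d' < c' × (∀ x → x ∈Λ Λ → x < c' → x ≤ d')

Acute : NumericalSemigroup → Set
Acute Λ = Ordinary Λ ⊎
  (¬ Ordinary Λ ×
   (∀ c d c' d' → IsConductor Λ c → IsDominant Λ c d → IsSubconductor Λ d c' →
      IsSubdominant Λ c' d' → c ∸ d ≤ c' ∸ d'))

module Submission where

-- Being
-- ordinary is decidable (it is a condition below the cofiniteness bound), so
-- it suffices to prove the inequality for every admissible conductor c,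
-- dominant d, subconductor c' and subdominant d' ('AcuteInequality').  Two
-- general facts are used throughout: c' - d' ≥ 2, and any element of Λ above
-- the dominant is at least the conductor.
--   * Symmetric and pseudo-symmetric semigroups satisfy 2g ≤ c + 1, i.e. at
--     least (c - 1)/2 elements lie below c.  Pairing x with c - 1 - x, at most
--     one of each pair is an element; if c - 2 were a gap, the pairs of 1 and
--     of c - 2 would consist of gaps only, which is too many gaps.  So c - 2
--     is an element and c - d ≤ 2 ≤ c' - d'.
--   * In an Arf semigroup d + c' - d' is an element above d, hence ≥ c.
--   * If Λ is generated by {i, …, j}, its elements form the blocks [k i, k j];
--     then c = (k + 1) i, d = k j, c' ≤ k i, and comparing with block k - 1
--     gives c + d' ≤ c' + d.

open import Defs
open import Data.Bool using (true; false; if_then_else_)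
open import Data.Empty using (⊥-elim)
open import Data.Nat using (ℕ; zero; suc; _+_; _*_; _∸_; _≤_; _<_; z≤n; s≤s; _≤?_; _<?_)
open import Data.Nat.Properties
open import Algebra.Properties.CommutativeSemigroup +-commutativeSemigroup
  using (interchange; x∙yz≈y∙xz)
open import Data.Product using (Σ; _×_; _,_; proj₁; proj₂)
open import Data.Sum using (_⊎_; inj₁; inj₂)
open import Relation.Nullary using (¬_; Dec; yes; no)
open import Relation.Nullary.Decidable using (_×-dec_; _→-dec_)
open import Relation.Binary.PropositionalEquality
  using (_≡_; refl; sym; trans; cong; cong₂; subst; module ≡-Reasoning)

Least : (ℕ → Set) → Set
Least P = Σ ℕ λ m → P m × (∀ {x} → x < m → ¬ P x)

module _ {P : ℕ → Set} (P? : ∀ x → Dec (P x)) where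

  leastBelow : ∀ n → (∀ {x} → x < n → ¬ P x) ⊎ Least P
  leastBelow zero = inj₁ λ ()
  leastBelow (suc n) with leastBelow n
  ... | inj₂ found = inj₂ found
  ... | inj₁ noneBelow with P? n
  ...   | yes Pn = inj₂ (n , Pn , noneBelow)
  ...   | no ¬Pn = inj₁ noneBelowSuc
    where
    noneBelowSuc : ∀ {x} → x < suc n → ¬ P x
    noneBelowSuc x<1+n with m<1+n⇒m<n∨m≡n x<1+n
    ... | inj₁ x<n  = noneBelow x<n
    ... | inj₂ refl = ¬Pn

  least : ∀ {n} → P n → Least P
  least {n} Pn with leastBelow (suc n)
  ... | inj₁ noneBelow = ⊥-elim (noneBelow ≤-refl Pn)
  ... | inj₂ found     = found

∸-≤-from-+ : ∀ c d c' d' → c + d' ≤ c' + d → c ∸ d ≤ c' ∸ d'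
∸-≤-from-+ c d c' d' c+d'≤c'+d = begin
  c ∸ d               ≡⟨ sym ([m+n]∸[m+o]≡n∸o d' c d) ⟩
  (d' + c) ∸ (d' + d) ≡⟨ cong₂ _∸_ (+-comm d' c) (+-comm d' d) ⟩
  (c + d') ∸ (d + d') ≤⟨ ∸-monoˡ-≤ (d + d') c+d'≤c'+d ⟩
  (c' + d) ∸ (d + d') ≡⟨ cong (_∸ (d + d')) (+-comm c' d) ⟩
  (d + c') ∸ (d + d') ≡⟨ [m+n]∸[m+o]≡n∸o d c' d' ⟩
  c' ∸ d'             ∎
  where open ≤-Reasoning

module Facts (Λ : NumericalSemigroup) where

  member? : ∀ x → Dec (x ∈Λ Λ)
  member? x with mem Λ x
  ... | true  = yes refl
  ... | false = no λ ()

  AcuteInequality : Set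
  AcuteInequality = ∀ c d c' d' → IsConductor Λ c → IsDominant Λ c d →
    IsSubconductor Λ d c' → IsSubdominant Λ c' d' → c ∸ d ≤ c' ∸ d'

  one∈Λ⇒all : 1 ∈Λ Λ → ∀ n → n ∈Λ Λ
  one∈Λ⇒all 1∈Λ zero    = zero-mem Λ
  one∈Λ⇒all 1∈Λ (suc n) = add-closed Λ 1 n 1∈Λ (one∈Λ⇒all 1∈Λ n)

  conductor-minimal : ∀ {c x} → IsConductor Λ c →
    (∀ {n} → x ≤ n → n < c → n ∈Λ Λ) → c ≤ x
  conductor-minimal {c} {x} (aboveC , minimal) run = minimal x fromX
    where
    fromX : ∀ n → x ≤ n → n ∈Λ Λ
    fromX n x≤n with n <? c
    ... | yes n<c = run x≤n n<c
    ... | no  n≮c = aboveC n (≮⇒≥ n≮c)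

  conductor-pred-gap : ∀ {c} → IsConductor Λ (suc c) → ¬ c ∈Λ Λ
  conductor-pred-gap {c} hc c∈Λ = 1+n≰n (conductor-minimal hc run)
    where
    run : ∀ {n} → c ≤ n → n < suc c → n ∈Λ Λ
    run c≤n n<1+c rewrite ≤-antisym (m<1+n⇒m≤n n<1+c) c≤n = c∈Λ

  conductor-unique : ∀ {c₁ c₂} → IsConductor Λ c₁ → IsConductor Λ c₂ → c₁ ≡ c₂
  conductor-unique h₁ h₂ = ≤-antisym (proj₂ h₁ _ (proj₁ h₂)) (proj₂ h₂ _ (proj₁ h₁))

  above-dominant : ∀ {c d x} → IsDominant Λ c d → x ∈Λ Λ → d < x → c ≤ x
  above-dominant (_ , _ , maximal) x∈Λ d<x = ≮⇒≥ λ x<c → <⇒≱ d<x (maximal _ x∈Λ x<c)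

  subconductor≤dominant : ∀ {c d c'} → IsDominant Λ c d → IsSubconductor Λ d c' → c' ≤ d
  subconductor≤dominant {d = d} (d∈Λ , _) (_ , _ , minimal) = minimal d d∈Λ onlyD
    where
    onlyD : ∀ n → d ≤ n → n ≤ d → n ∈Λ Λ
    onlyD n d≤n n≤d rewrite ≤-antisym n≤d d≤n = d∈Λ

  -- c' - 1 is a gap (else [c' - 1, d] ⊆ Λ would contradict minimality of c'),
  -- so c' - d' ≥ 2.
  subdominant-gap : ∀ {d c' d'} → IsSubconductor Λ d c' → IsSubdominant Λ c' d' →
    2 + d' ≤ c'
  subdominant-gap {d} {c'} {d'} (_ , run , minimal) (d'∈Λ , d'<c' , _)
    with m≤n⇒m<n∨m≡n d'<c'
  ... | inj₁ 1+d'<c' = 1+d'<c'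
  ... | inj₂ 1+d'≡c' = ⊥-elim (<⇒≱ d'<c' (minimal d' d'∈Λ runFromD'))
    where
    runFromD' : ∀ n → d' ≤ n → n ≤ d → n ∈Λ Λ
    runFromD' n d'≤n n≤d with m≤n⇒m<n∨m≡n d'≤n
    ... | inj₁ d'<n = run n (subst (_≤ n) 1+d'≡c' d'<n) n≤d
    ... | inj₂ refl = d'∈Λ

  dominant-positive : ∀ {c d c' d'} → IsDominant Λ c d → IsSubconductor Λ d c' →
    IsSubdominant Λ c' d' → 1 ≤ d
  dominant-positive hd hs (_ , d'<c' , _) =
    ≤-trans (s≤s z≤n) (≤-trans d'<c' (subconductor≤dominant hd hs))

  PositiveElement : ℕ → Set
  PositiveElement x = 1 ≤ x × x ∈Λ Λ

  ordinary-upward : Ordinary Λ → ∀ {m} → PositiveElement m → ∀ {y} → m ≤ y → y ∈Λ Λ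
  ordinary-upward (_ , ordinary) (1≤m , m∈Λ) m≤y with proj₁ (ordinary _) m∈Λ
  ... | inj₁ refl = ⊥-elim (1+n≰n 1≤m)
  ... | inj₂ c≤m  = proj₂ (ordinary _) (inj₂ (≤-trans c≤m m≤y))

  ordinary-from-least : ∀ {m} → (∀ {x} → x < m → ¬ PositiveElement x) →
    (∀ {y} → m ≤ y → y ∈Λ Λ) → Ordinary Λ
  ordinary-from-least {m} noneBelow upward = m , λ n → zeroOrAbove n , fromZeroOrAbove n
    where
    zeroOrAbove : ∀ n → n ∈Λ Λ → n ≡ 0 ⊎ m ≤ n
    zeroOrAbove zero    _   = inj₁ refl
    zeroOrAbove (suc n) n∈Λ = inj₂ (≮⇒≥ λ n<m → noneBelow n<m (s≤s z≤n , n∈Λ))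
    fromZeroOrAbove : ∀ n → n ≡ 0 ⊎ m ≤ n → n ∈Λ Λ
    fromZeroOrAbove _ (inj₁ refl) = zero-mem Λ
    fromZeroOrAbove _ (inj₂ m≤n)  = upward m≤n

  -- Λ is ordinary iff [m, ∞) ⊆ Λ for its least positive element m, and this
  -- only has to be checked below the cofiniteness bound N.
  ordinary? : Dec (Ordinary Λ)
  ordinary? with cofinite Λ
  ... | N , cofin with least (λ x → (1 ≤? x) ×-dec member? x)
                             {suc N} (s≤s z≤n , cofin (suc N) (n≤1+n N))
  ... | m , m-positive , noneBelow
      with allUpTo? (λ y → (m ≤? y) →-dec member? y) N
  ... | yes upwardBelowN = yes (ordinary-from-least noneBelow upward)
    where
    upward : ∀ {y} → m ≤ y → y ∈Λ Λ
    upward {y} m≤y with y <? N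
    ... | yes y<N = upwardBelowN y<N m≤y
    ... | no  y≮N = cofin y (≮⇒≥ y≮N)
  ... | no ¬upwardBelowN =
    no λ ordinary → ¬upwardBelowN λ _ m≤y → ordinary-upward ordinary m-positive m≤y

  acute-from-inequality : AcuteInequality → Acute Λ
  acute-from-inequality inequality with ordinary?
  ... | yes ordinary  = inj₁ ordinary
  ... | no ¬ordinary  = inj₂ (¬ordinary , inequality)

increasing-reflects-≤ : ∀ {e : ℕ → ℕ} → (∀ m n → m < n → e m < e n) →
  ∀ {a b} → e a ≤ e b → a ≤ b
increasing-reflects-≤ increasing {a} {b} ea≤eb =
  ≮⇒≥ λ b<a → <⇒≱ (increasing b a b<a) ea≤eb

-- Arf semigroups: writing d = λ_a, c' = λ_b, d' = λ_k with a ≥ b ≥ k, the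
-- element λ_a + λ_b - λ_k = d + (c' - d') lies above d, hence is ≥ c.
arf-acute : (Λ : NumericalSemigroup) → Arf Λ → Facts.AcuteInequality Λ
arf-acute Λ (e , (_ , increasing , onto) , arf) c d c' d' _ hd hs hsd@(_ , d'<c' , _)
  with onto d (proj₁ hd) | onto c' (proj₁ hs) | onto d' (proj₁ hsd)
... | a , refl | b , refl | k , refl = begin
  c ∸ e a                   ≤⟨ ∸-monoˡ-≤ (e a) (above-dominant hd x∈Λ d<x) ⟩
  x ∸ e a                   ≡⟨ cong (_∸ e a) x≡ ⟩
  e a + (e b ∸ e k) ∸ e a   ≡⟨ m+n∸m≡n (e a) (e b ∸ e k) ⟩
  e b ∸ e k                 ∎
  where
  open Facts Λ
  open ≤-Reasoning
  x : ℕ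
  x = e a + e b ∸ e k
  x∈Λ : x ∈Λ Λ
  x∈Λ = arf a b k (increasing-reflects-≤ increasing (subconductor≤dominant hd hs))
                  (increasing-reflects-≤ increasing (<⇒≤ d'<c'))
  x≡ : x ≡ e a + (e b ∸ e k)
  x≡ = +-∸-assoc (e a) (<⇒≤ d'<c')
  d<x : e a < x
  d<x = subst (e a <_) (sym x≡) (m<m+n (e a) (m<n⇒0<n∸m d'<c'))

sumBelow : (ℕ → ℕ) → ℕ → ℕ
sumBelow f zero    = 0
sumBelow f (suc n) = sumBelow f n + f n

sumBelow-+ : ∀ f g n → sumBelow (λ x → f x + g x) n ≡ sumBelow f n + sumBelow g n
sumBelow-+ f g zero    = refl
sumBelow-+ f g (suc n) =
  trans (cong (_+ (f n + g n)) (sumBelow-+ f g n))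
        (interchange (sumBelow f n) (sumBelow g n) (f n) (g n))

sumBelow-first : ∀ f n → sumBelow f (suc n) ≡ f 0 + sumBelow (λ x → f (suc x)) n
sumBelow-first f zero    = +-comm 0 (f 0)
sumBelow-first f (suc n) =
  trans (cong (_+ f (suc n)) (sumBelow-first f n)) (+-assoc (f 0) _ _)

sumBelow-reverse : ∀ f n → sumBelow (λ x → f (n ∸ suc x)) n ≡ sumBelow f n
sumBelow-reverse f zero    = refl
sumBelow-reverse f (suc n) = begin
  sumBelow (λ x → f (n ∸ x)) (suc n)        ≡⟨ sumBelow-first (λ x → f (n ∸ x)) n ⟩
  f n + sumBelow (λ x → f (n ∸ suc x)) n    ≡⟨ cong (f n +_) (sumBelow-reverse f n) ⟩
  f n + sumBelow f n                         ≡⟨ +-comm (f n) (sumBelow f n) ⟩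
  sumBelow f n + f n                         ∎
  where open ≡-Reasoning

+-≤-suc : ∀ {s n t} → s ≤ n → t ≤ 1 → s + t ≤ suc n
+-≤-suc {s} {n} {t} s≤n t≤1 = subst (s + t ≤_) (+-comm n 1) (+-mono-≤ s≤n t≤1)

+-≤-zero : ∀ {s n t} → t ≡ 0 → s ≤ n → s + t ≤ n
+-≤-zero {s} refl s≤n = subst (_≤ _) (sym (+-identityʳ s)) s≤n

module ZeroOneSums (f : ℕ → ℕ) where

  ZeroOneBelow : ℕ → Set
  ZeroOneBelow n = ∀ {x} → x < n → f x ≤ 1

  zeroOne-pred : ∀ {n} → ZeroOneBelow (suc n) → ZeroOneBelow n
  zeroOne-pred bounded x<n = bounded (m≤n⇒m≤1+n x<n)

  sumBelow-≤ : ∀ n → ZeroOneBelow n → sumBelow f n ≤ n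
  sumBelow-≤ zero    _       = z≤n
  sumBelow-≤ (suc n) bounded =
    +-≤-suc (sumBelow-≤ n (zeroOne-pred bounded)) (bounded ≤-refl)

  sumBelow-one-zero : ∀ n {a} → a < n → f a ≡ 0 → ZeroOneBelow n →
    1 + sumBelow f n ≤ n
  sumBelow-one-zero (suc n) a<1+n fa≡0 bounded with m<1+n⇒m<n∨m≡n a<1+n
  ... | inj₁ a<n =
    +-≤-suc (sumBelow-one-zero n a<n fa≡0 (zeroOne-pred bounded)) (bounded ≤-refl)
  ... | inj₂ refl = s≤s (+-≤-zero fa≡0 (sumBelow-≤ n (zeroOne-pred bounded)))

  sumBelow-two-zeros : ∀ n {a b} → a < b → b < n → f a ≡ 0 → f b ≡ 0 →
    ZeroOneBelow n → 2 + sumBelow f n ≤ n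
  sumBelow-two-zeros (suc n) a<b b<1+n fa≡0 fb≡0 bounded with m<1+n⇒m<n∨m≡n b<1+n
  ... | inj₁ b<n = +-≤-suc
    (sumBelow-two-zeros n a<b b<n fa≡0 fb≡0 (zeroOne-pred bounded)) (bounded ≤-refl)
  ... | inj₂ refl =
    s≤s (+-≤-zero fb≡0 (sumBelow-one-zero n a<b fa≡0 (zeroOne-pred bounded)))

genus-bound : ∀ {g e c} → g + e ≡ c → 2 * g ≤ c + 1 → c ≤ suc (e + e)
genus-bound {g} {e} {c} g+e≡c 2g≤c+1 = begin
  c      ≡⟨ sym g+e≡c ⟩
  g + e  ≤⟨ +-monoˡ-≤ e g≤1+e ⟩
  suc e + e ∎
  where
  open ≤-Reasoning
  g≤1+e : g ≤ suc e
  g≤1+e = +-cancelˡ-≤ g g (suc e) (begin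
    g + g         ≡⟨ cong (g +_) (sym (+-identityʳ g)) ⟩
    2 * g         ≤⟨ 2g≤c+1 ⟩
    c + 1         ≡⟨ cong (_+ 1) (sym g+e≡c) ⟩
    g + e + 1     ≡⟨ +-assoc g e 1 ⟩
    g + (e + 1)   ≡⟨ cong (g +_) (+-comm e 1) ⟩
    g + suc e     ∎)

module FewGaps (Λ : NumericalSemigroup) where
  open Facts Λ
  open ZeroOneSums

  indicator : ℕ → ℕ
  indicator x = if mem Λ x then 1 else 0

  elementsBelow : ℕ → ℕ
  elementsBelow = sumBelow indicator

  indicator-gap : ∀ {x} → ¬ x ∈Λ Λ → indicator x ≡ 0
  indicator-gap {x} x∉Λ with mem Λ x
  ... | true  = ⊥-elim (x∉Λ refl)
  ... | false = refl

  gaps+elements : ∀ n → gapsBelow Λ n + elementsBelow n ≡ n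
  gaps+elements zero    = refl
  gaps+elements (suc n) = begin
    (gapsBelow Λ n + gapIndicator) + (elementsBelow n + indicator n)
      ≡⟨ interchange (gapsBelow Λ n) gapIndicator (elementsBelow n) (indicator n) ⟩
    (gapsBelow Λ n + elementsBelow n) + (gapIndicator + indicator n)
      ≡⟨ cong₂ _+_ (gaps+elements n) complementary ⟩
    n + 1
      ≡⟨ +-comm n 1 ⟩
    suc n ∎
    where
    open ≡-Reasoning
    gapIndicator : ℕ
    gapIndicator = if mem Λ n then 0 else 1
    complementary : gapIndicator + indicator n ≡ 1
    complementary with mem Λ n
    ... | true  = refl
    ... | false = refl

  gapsBelow-stable : ∀ {c} → IsConductor Λ c → ∀ k → gapsBelow Λ (c + k) ≡ gapsBelow Λ c
  gapsBelow-stable {c} hc zero    = cong (gapsBelow Λ) (+-identityʳ c)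
  gapsBelow-stable {c} hc (suc k) rewrite +-suc c k
    with mem Λ (c + k) | proj₁ hc (c + k) (m≤m+n c k)
  ... | true | _ = trans (+-identityʳ _) (gapsBelow-stable hc k)

  genus-gapsBelow : ∀ {c g} → IsConductor Λ c → IsGenus Λ g → g ≡ gapsBelow Λ c
  genus-gapsBelow {c} {g} hc (N , cofin , g≡) = begin
    g                         ≡⟨ g≡ ⟩
    gapsBelow Λ N             ≡⟨ cong (gapsBelow Λ) (sym (m+[n∸m]≡n (proj₂ hc N cofin))) ⟩
    gapsBelow Λ (c + (N ∸ c)) ≡⟨ gapsBelow-stable hc (N ∸ c) ⟩
    gapsBelow Λ c             ∎
    where open ≡-Reasoning

  -- With conductor c + 1, x and c - x sum to the gap c, so at most one of them
  -- is an element.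
  pair-zeroOne : ∀ {c} → IsConductor Λ (suc c) →
    ZeroOneBelow (λ x → indicator x + indicator (c ∸ x)) (suc c)
  pair-zeroOne {c} hc {x} x<1+c with mem Λ x in x∈Λ | mem Λ (c ∸ x) in c-x∈Λ
  ... | true  | true  = ⊥-elim (conductor-pred-gap hc
    (subst (_∈Λ Λ) (m+[n∸m]≡n (m<1+n⇒m≤n x<1+c)) (add-closed Λ x (c ∸ x) x∈Λ c-x∈Λ)))
  ... | true  | false = ≤-refl
  ... | false | true  = ≤-refl
  ... | false | false = z≤n

  -- With conductor c + 1: if a < c - a are both gaps, summing the pairing over
  -- x ≤ c gives 2 + 2e ≤ c + 1, where e counts the elements below c + 1.
  symmetric-gap-pair : ∀ {c} → IsConductor Λ (suc c) → ∀ {a} → a < c ∸ a →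
    ¬ a ∈Λ Λ → ¬ (c ∸ a) ∈Λ Λ →
    2 + (elementsBelow (suc c) + elementsBelow (suc c)) ≤ suc c
  symmetric-gap-pair {c} hc {a} a<c-a a∉Λ c-a∉Λ =
    subst (λ s → 2 + s ≤ suc c) pairedSum
      (sumBelow-two-zeros paired (suc c) a<c-a (s≤s (m∸n≤m c a))
        pairedA pairedC-a (pair-zeroOne hc))
    where
    paired : ℕ → ℕ
    paired x = indicator x + indicator (c ∸ x)
    a≤c : a ≤ c
    a≤c = ≤-trans (<⇒≤ a<c-a) (m∸n≤m c a)
    pairedA : paired a ≡ 0
    pairedA = cong₂ _+_ (indicator-gap a∉Λ) (indicator-gap c-a∉Λ)
    pairedC-a : paired (c ∸ a) ≡ 0
    pairedC-a = cong₂ _+_ (indicator-gap c-a∉Λ)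
      (trans (cong indicator (m∸[m∸n]≡n a≤c)) (indicator-gap a∉Λ))
    pairedSum : sumBelow paired (suc c) ≡ elementsBelow (suc c) + elementsBelow (suc c)
    pairedSum = trans (sumBelow-+ indicator (λ x → indicator (c ∸ x)) (suc c))
                      (cong (elementsBelow (suc c) +_) (sumBelow-reverse indicator (suc c)))

  -- With c ≤ 2e + 1, the integer c - 2 (for c ≥ 3) cannot be a gap: for
  -- c = 3 the dominant would be 0, for c ≥ 4 the gaps 1 and c - 2 form a pair.
  conductor-minus-two-element : ∀ c {d} → IsConductor Λ (3 + c) →
    3 + c ≤ suc (elementsBelow (3 + c) + elementsBelow (3 + c)) →
    IsDominant Λ (3 + c) d → 1 ≤ d → ¬ ¬ suc c ∈Λ Λ
  conductor-minus-two-element zero {zero} _ _ _ () _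
  conductor-minus-two-element zero {suc zero} _ _ (1∈Λ , _) _ 1∉Λ = 1∉Λ 1∈Λ
  conductor-minus-two-element zero {suc (suc zero)} hc _ (2∈Λ , _) _ _ =
    conductor-pred-gap hc 2∈Λ
  conductor-minus-two-element zero {suc (suc (suc _))} _ _ (_ , s≤s (s≤s (s≤s ())) , _) _ _
  conductor-minus-two-element (suc c) hc bound _ _ c-2∉Λ =
    1+n≰n (≤-trans (symmetric-gap-pair hc (s≤s (s≤s z≤n)) 1∉Λ c-2∉Λ) bound)
    where
    1∉Λ : ¬ 1 ∈Λ Λ
    1∉Λ 1∈Λ = conductor-pred-gap hc (one∈Λ⇒all 1∈Λ _)

  dominant-near-conductor : ∀ {c d} → IsConductor Λ c →
    c ≤ suc (elementsBelow c + elementsBelow c) → IsDominant Λ c d → 1 ≤ d → c ≤ 2 + d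
  dominant-near-conductor {zero}             _ _ _ _ = z≤n
  dominant-near-conductor {suc zero}         _ _ _ _ = s≤s z≤n
  dominant-near-conductor {suc (suc zero)}   _ _ _ _ = s≤s (s≤s z≤n)
  dominant-near-conductor {suc (suc (suc c))} hc bound hd@(_ , _ , maximal) 1≤d
    with member? (suc c)
  ... | yes c-2∈Λ = s≤s (s≤s (maximal (suc c) c-2∈Λ (s≤s (n≤1+n (suc c)))))
  ... | no  c-2∉Λ = ⊥-elim (conductor-minus-two-element c hc bound hd 1≤d c-2∉Λ)

  -- If 2g ≤ c + 1 then c - d ≤ 2 ≤ c' - d'.
  small-genus-acute : ∀ {c g} → IsConductor Λ c → IsGenus Λ g → 2 * g ≤ c + 1 →
    AcuteInequality
  small-genus-acute {c} {g} hc hg 2g≤c+1 c₁ d c' d' hc₁ hd hs hsd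
    with conductor-unique hc₁ hc
  ... | refl = ≤-trans (m≤n+o⇒m∸n≤o c d c≤d+2) (m+n≤o⇒m≤o∸n 2 (subdominant-gap hs hsd))
    where
    fewGaps : c ≤ suc (elementsBelow c + elementsBelow c)
    fewGaps = genus-bound {g = g}
      (trans (cong (_+ elementsBelow c) (genus-gapsBelow hc hg)) (gaps+elements c)) 2g≤c+1
    c≤d+2 : c ≤ d + 2
    c≤d+2 = subst (c ≤_) (+-comm 2 d)
      (dominant-near-conductor hc fewGaps hd (dominant-positive hd hs hsd))

module IntervalBlocks (i j : ℕ) (i≤j : i ≤ j) where

  gen-block : ∀ {n} → GenByInterval i j n → Σ ℕ λ k → k * i ≤ n × n ≤ k * j
  gen-block gen-zero = 0 , z≤n , z≤n
  gen-block (gen-step i≤t t≤j g) with gen-block g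
  ... | k , ki≤n , n≤kj = suc k , +-mono-≤ i≤t ki≤n , +-mono-≤ t≤j n≤kj

  -- Fill block k + 1 greedily: use generator i if the rest stays in block k,
  -- otherwise top up k j with a single generator.
  block-gen : ∀ k n → k * i ≤ n → n ≤ k * j → GenByInterval i j n
  block-gen zero    zero    _ _ = gen-zero
  block-gen zero    (suc n) _ ()
  block-gen (suc k) n lower upper with n ≤? i + k * j
  ... | yes n≤i+kj = subst (GenByInterval i j) (m+[n∸m]≡n i≤n)
          (gen-step ≤-refl i≤j (block-gen k (n ∸ i) lower' (m≤n+o⇒m∸n≤o n i n≤i+kj)))
    where
    i≤n : i ≤ n
    i≤n = ≤-trans (m≤m+n i (k * i)) lower
    lower' : k * i ≤ n ∸ i
    lower' = m+n≤o⇒m≤o∸n (k * i) (subst (_≤ n) (+-comm i (k * i)) lower)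
  ... | no  n≰i+kj = subst (GenByInterval i j) (m∸n+n≡m kj≤n)
          (gen-step i≤n-kj n-kj≤j (block-gen k (k * j) (*-monoʳ-≤ k i≤j) ≤-refl))
    where
    i+kj≤n : i + k * j ≤ n
    i+kj≤n = <⇒≤ (≰⇒> n≰i+kj)
    kj≤n : k * j ≤ n
    kj≤n = m+n≤o⇒n≤o i i+kj≤n
    i≤n-kj : i ≤ n ∸ k * j
    i≤n-kj = m+n≤o⇒m≤o∸n i i+kj≤n
    n-kj≤j : n ∸ k * j ≤ j
    n-kj≤j = m≤n+o⇒m∸n≤o n (k * j) (subst (n ≤_) (+-comm j (k * j)) upper)

add-generator-bounds : ∀ {i j K L c' d'} → i ≤ j → K + d' ≤ c' + L →
  (i + K) + d' ≤ c' + (j + L)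
add-generator-bounds {i} {j} {K} {L} {c'} {d'} i≤j K+d'≤c'+L = begin
  (i + K) + d'   ≡⟨ +-assoc i K d' ⟩
  i + (K + d')   ≤⟨ +-mono-≤ i≤j K+d'≤c'+L ⟩
  j + (c' + L)   ≡⟨ x∙yz≈y∙xz j c' L ⟩
  c' + (j + L)   ∎
  where open ≤-Reasoning

module IntervalCase (Λ : NumericalSemigroup) (i j : ℕ) (1≤i : 1 ≤ i) (i≤j : i ≤ j)
  (generated : ∀ n → (n ∈Λ Λ → GenByInterval i j n) × (GenByInterval i j n → n ∈Λ Λ))
  where
  open Facts Λ
  open IntervalBlocks i j i≤j

  block⊆Λ : ∀ k {n} → k * i ≤ n → n ≤ k * j → n ∈Λ Λ
  block⊆Λ k {n} ki≤n n≤kj = proj₂ (generated n) (block-gen k n ki≤n n≤kj)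

  below-next-block : ∀ k {x} → x ∈Λ Λ → x < suc k * i → x ≤ k * j
  below-next-block k {x} x∈Λ x<next with gen-block (proj₁ (generated x) x∈Λ)
  ... | k' , k'i≤x , x≤k'j with k' ≤? k
  ...   | yes k'≤k = ≤-trans x≤k'j (*-monoˡ-≤ j k'≤k)
  ...   | no  k'≰k = ⊥-elim (<⇒≱ x<next (≤-trans (*-monoˡ-≤ i (≰⇒> k'≰k)) k'i≤x))

  above-block : ∀ k {x} → x ∈Λ Λ → k * j < x → suc k * i ≤ x
  above-block k x∈Λ kj<x = ≮⇒≥ λ x<next → <⇒≱ kj<x (below-next-block k x∈Λ x<next)

  conductor-in-block : ∀ k {c} → IsConductor Λ c → c ≤ k * j → c ≤ k * i
  conductor-in-block k hc c≤kj =
    conductor-minimal hc λ ki≤n n<c → block⊆Λ k ki≤n (≤-trans (<⇒≤ n<c) c≤kj)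

  conductor-block-start : ∀ {c} → IsConductor Λ c → Σ ℕ λ k → c ≡ k * i
  conductor-block-start {c} hc with gen-block (proj₁ (generated c) (proj₁ hc c ≤-refl))
  ... | k , ki≤c , c≤kj = k , ≤-antisym (conductor-in-block k hc c≤kj) ki≤c

  dominant-block-end : ∀ k {d} → IsConductor Λ (suc k * i) →
    IsDominant Λ (suc k * i) d → d ≡ k * j
  dominant-block-end k hc (d∈Λ , d<c , maximal) =
    ≤-antisym (below-next-block k d∈Λ d<c) (maximal _ (block⊆Λ k (*-monoʳ-≤ k i≤j) ≤-refl) kj<c)
    where
    ki<c : k * i < suc k * i
    ki<c = +-monoˡ-≤ (k * i) 1≤i
    kj<c : k * j < suc k * i
    kj<c = ≰⇒> λ c≤kj → <⇒≱ ki<c (conductor-in-block k hc c≤kj)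

  subconductor-block-start : ∀ k {c'} → IsSubconductor Λ (k * j) c' → c' ≤ k * i
  subconductor-block-start k (_ , _ , minimal) =
    minimal (k * i) (block⊆Λ k ≤-refl (*-monoʳ-≤ k i≤j)) λ n ki≤n n≤kj → block⊆Λ k ki≤n n≤kj

  -- With d = (k + 1) j and c' ≤ (k + 1) i, compare c' with block k: either
  -- c' lies beyond it (then c' ≥ (k + 1) i and d' ≤ k j), or k j + 1 ∈ [c', d]
  -- is an element, so block k + 1 starts by k j + 1.
  subconductor-vs-previous-block : ∀ k {c' d'} → IsSubconductor Λ (suc k * j) c' →
    IsSubdominant Λ c' d' → c' ≤ suc k * i → suc k * i + d' ≤ c' + k * j
  subconductor-vs-previous-block k {c'} {d'} (c'∈Λ , run , _) (d'∈Λ , d'<c' , _) c'≤K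
    with k * j <? c'
  ... | yes kj<c' = +-mono-≤ (above-block k c'∈Λ kj<c')
                             (below-next-block k d'∈Λ (<-≤-trans d'<c' c'≤K))
  ... | no  kj≮c' = begin
    suc k * i + d'   ≤⟨ +-monoˡ-≤ d' (above-block k kj+1∈Λ ≤-refl) ⟩
    suc (k * j) + d' ≡⟨ sym (+-suc (k * j) d') ⟩
    k * j + suc d'   ≤⟨ +-monoʳ-≤ (k * j) d'<c' ⟩
    k * j + c'       ≡⟨ +-comm (k * j) c' ⟩
    c' + k * j       ∎
    where
    open ≤-Reasoning
    kj+1∈Λ : suc (k * j) ∈Λ Λ
    kj+1∈Λ = run (suc (k * j)) (≤-trans (≮⇒≥ kj≮c') (n≤1+n _))
                 (+-monoˡ-≤ (k * j) (≤-trans 1≤i i≤j))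

  -- c = (k + 1) i, d = k j and c' ≤ k i; for k = 0 there is no room for d'.
  acute-from-blocks : ∀ k {c' d'} → IsSubconductor Λ (k * j) c' → IsSubdominant Λ c' d' →
    c' ≤ k * i → suc k * i ∸ k * j ≤ c' ∸ d'
  acute-from-blocks zero    _  (_ , d'<c' , _) c'≤0 = ⊥-elim (<⇒≱ d'<c' (≤-trans c'≤0 z≤n))
  acute-from-blocks (suc k) {c'} {d'} hs hsd c'≤K = ∸-≤-from-+ (suc (suc k) * i) (suc k * j) c' d'
    (add-generator-bounds {L = k * j} {c' = c'} i≤j (subconductor-vs-previous-block k hs hsd c'≤K))

  interval-acute : AcuteInequality
  interval-acute c d c' d' hc hd hs hsd with conductor-block-start hc
  ... | zero  , refl = ⊥-elim (<⇒≱ (proj₁ (proj₂ hd)) z≤n)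
  ... | suc k , refl with dominant-block-end k hc hd
  ...   | refl = acute-from-blocks k hs hsd (subconductor-block-start k hs)

mainTheorem8 : (Λ : NumericalSemigroup) →
    (Symmetric Λ → Acute Λ) × (PseudoSymmetric Λ → Acute Λ) ×
    (Arf Λ → Acute Λ) × (IntervalGenerated Λ → Acute Λ)
mainTheorem8 Λ = symmetric , pseudoSymmetric , arf , interval
  where
  open Facts Λ
  open FewGaps Λ using (small-genus-acute)

  symmetric : Symmetric Λ → Acute Λ
  symmetric (c , g , hc , hg , c≡2g) =
    acute-from-inequality (small-genus-acute hc hg (≤-trans (≤-reflexive (sym c≡2g)) (m≤m+n c 1)))

  pseudoSymmetric : PseudoSymmetric Λ → Acute Λ
  pseudoSymmetric (c , g , hc , hg , c+1≡2g) =
    acute-from-inequality (small-genus-acute hc hg (≤-reflexive (sym c+1≡2g)))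

  arf : Arf Λ → Acute Λ
  arf isArf = acute-from-inequality (arf-acute Λ isArf)

  interval : IntervalGenerated Λ → Acute Λ
  interval (i , j , 1≤i , i≤j , generated) =
    acute-from-inequality (IntervalCase.interval-acute Λ i j 1≤i i≤j generated)
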